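{- Suppose given an element of $\prod_{x:\mathbb{R}_D}\operatorname{locator}(x)$. Then one can define a function $f:\mathbb{R}_D\to\mathbf{2}$ that is strongly non-constant, in the sense that there exist reals $x,y:\mathbb{R}_D$ with $f(x)\neq f(y)$.
   Context: Work in Martin-Löf type theory with propositional truncation, function extensionality and propositional extensionality. $\mathbf{2}$ is the type of Booleans. A Dedekind real is a pair $x=(L,U)$ of proposition-valued predicates on $\mathbb{Q}$, writing $q<x$ for $q\in L$ and $x<r$ for $r\in U$, which is bounded, rounded, transitive and located ($q<r\Rightarrow\|(q<x)+(x<r)\|$). $\mathbb{R}_D$ is the type of Dedekind reals. A locator for $x$ is a function $\prod_{q,r:\mathbb{Q}}(q<r)\to(q<x)+(x<r)$ into the untruncated disjoint sum; $\operatorname{locator}(x)$ is the type of locators for $x$. -}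

module Defs where

open import Level using (Level; _⊔_) renaming (suc to lsuc; zero to lzero)
open import Data.Rational using (ℚ; _<_)
open import Data.Product using (Σ; _×_; _,_)
open import Data.Sum using (_⊎_)
open import Relation.Binary.PropositionalEquality using (_≡_)

isProp : ∀ {a} → Set a → Set a
isProp A = (x y : A) → x ≡ y

-- propositional truncation, impredicative encoding (no HITs in --safe Agda)
∥_∥ : ∀ {a} → Set a → Set (lsuc a)
∥_∥ {a} A = (P : Set a) → isProp P → (A → P) → P

∣_∣ : ∀ {a} {A : Set a} → A → ∥ A ∥
∣ x ∣ = λ P _ f → f x

record ℝD : Set₁ where
  field
    L : ℚ → Set
    U : ℚ → Set
    L-prop : ∀ q → isProp (L q)
    U-prop : ∀ r → isProp (U r)
    bounded-L : ∥ Σ ℚ L ∥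
    bounded-U : ∥ Σ ℚ U ∥
    rounded-L : ∀ q → (L q → ∥ Σ ℚ (λ q' → q < q' × L q') ∥)
                    × (∥ Σ ℚ (λ q' → q < q' × L q') ∥ → L q)
    rounded-U : ∀ r → (U r → ∥ Σ ℚ (λ r' → r' < r × U r') ∥)
                    × (∥ Σ ℚ (λ r' → r' < r × U r') ∥ → U r)
    transitive : ∀ q r → L q → U r → q < r
    located : ∀ q r → q < r → ∥ L q ⊎ U r ∥

open ℝD public

_<ℝ_ : ℚ → ℝD → Set
q <ℝ x = L x q

_ℝ<_ : ℝD → ℚ → Set
x ℝ< r = U x r

locator : ℝD → Set
locator x = (q r : ℚ) → q < r → (q <ℝ x) ⊎ (x ℝ< r)

{-# OPTIONS --safe #-}
-- A locator's answer is untruncated, so its tag can be read off as a Boolean: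
-- query the locator of x at 0 < 1 and return true iff it answers 0 < x.  Every
-- answer is a true statement, which forces true at 2 and false at -1.
module Submission where

open import Defs
open import Data.Bool using (Bool; true; false)
open import Data.Maybe using (is-just)
open import Data.Product using (Σ; _,_)
open import Data.Sum using (inj₁; inj₂; isInj₁)
open import Data.Empty using (⊥-elim)
open import Relation.Binary.PropositionalEquality using (_≡_; _≢_; refl; subst)
open import Relation.Binary.Definitions using (Cotransitive; tri<; tri≈; tri>)
open import Data.Rational using (ℚ; _<_; _+_; _-_; -_; 0ℚ; 1ℚ)
open import Data.Rational.Properties
  using ( <-irrelevant; <-irrefl; <-trans; <-dense; <-cmp
        ; +-identityʳ; +-monoʳ-<; positive⁻¹; negative⁻¹ )

<-cotrans : Cotransitive _<_
<-cotrans {q} q<r c with <-cmp q c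
... | tri< q<c _ _ = inj₁ q<c
... | tri≈ _ refl _ = inj₂ q<r
... | tri> _ _ c<q = inj₂ (<-trans c<q q<r)

0<1 : 0ℚ < 1ℚ
0<1 = positive⁻¹ 1ℚ

p<p+1 : ∀ p → p < p + 1ℚ
p<p+1 p = subst (_< p + 1ℚ) (+-identityʳ p) (+-monoʳ-< p 0<1)

p-1<p : ∀ p → p - 1ℚ < p
p-1<p p = subst (p - 1ℚ <_) (+-identityʳ p) (+-monoʳ-< p (negative⁻¹ (- 1ℚ)))

fromℚ : ℚ → ℝD
fromℚ c = record
  { L = _< c
  ; U = c <_
  ; L-prop = λ _ → <-irrelevant
  ; U-prop = λ _ → <-irrelevant
  ; bounded-L = ∣ c - 1ℚ , p-1<p c ∣
  ; bounded-U = ∣ c + 1ℚ , p<p+1 c ∣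
  ; rounded-L = λ q → (λ q<c → let m , q<m , m<c = <-dense q<c in ∣ m , q<m , m<c ∣)
                    , (λ ∃q' → ∃q' (q < c) <-irrelevant λ { (_ , q<q' , q'<c) → <-trans q<q' q'<c })
  ; rounded-U = λ r → (λ c<r → let m , c<m , m<r = <-dense c<r in ∣ m , m<r , c<m ∣)
                    , (λ ∃r' → ∃r' (c < r) <-irrelevant λ { (_ , r'<r , c<r') → <-trans c<r' r'<r })
  ; transitive = λ _ _ → <-trans
  ; located = λ _ _ q<r → ∣ <-cotrans q<r c ∣
  }

isAbove : (x : ℝD) → locator x → (q r : ℚ) → q < r → Bool
isAbove _ ℓ q r q<r = is-just (isInj₁ (ℓ q r q<r))

module _ (x : ℝD) (ℓ : locator x) {q r : ℚ} (q<r : q < r) where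

  isAbove-true : r <ℝ x → isAbove x ℓ q r q<r ≡ true
  isAbove-true r<x with ℓ q r q<r
  ... | inj₁ _ = refl
  ... | inj₂ x<r = ⊥-elim (<-irrefl refl (transitive x r r r<x x<r))

  isAbove-false : x ℝ< q → isAbove x ℓ q r q<r ≡ false
  isAbove-false x<q with ℓ q r q<r
  ... | inj₁ q<x = ⊥-elim (<-irrefl refl (transitive x q q q<x x<q))
  ... | inj₂ _ = refl

lemma3p41 : ((x : ℝD) → locator x) →
    Σ (ℝD → Bool) (λ f → ∥ Σ ℝD (λ x → Σ ℝD (λ y → f x ≢ f y)) ∥)
lemma3p41 loc = f , ∣ two , minusOne , f-separates ∣
  where
  two minusOne : ℝD
  two = fromℚ (1ℚ + 1ℚ)
  minusOne = fromℚ (0ℚ - 1ℚ)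

  f : ℝD → Bool
  f x = isAbove x (loc x) 0ℚ 1ℚ 0<1

  f-separates : f two ≢ f minusOne
  f-separates
    rewrite isAbove-true two (loc two) 0<1 (p<p+1 1ℚ)
          | isAbove-false minusOne (loc minusOne) 0<1 (p-1<p 0ℚ) = λ ()
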